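{- Fix $K\ge1$ and a finite alphabet $\Sigma$. There is a tuple $\mathcal{I}_C=(\Delta;S_0',S_1',(P_a')_{a\in\Sigma})$ of MSO-formulae over the word signature of $\widehat\Sigma$ (with free first-order variables only; $\Delta$ with one, $S'_0,S'_1$ with two, $P'_a$ with one) such that for every tree $t\in T^K_\Sigma$ there is an injective map $f_C\colon\operatorname{dom}(t)\to\operatorname{dom}(C(t))$ for which $\langle f_C,\mathcal{I}_C\rangle$ is an MSO-interpretation of $t$ in $C(t)$, i.e. $f_C(\operatorname{dom}(t))=\Delta^{C(t)}$, $f_C(S_d^t)=S_d'^{\,C(t)}$ for $d\in\{0,1\}$, and $f_C(P_a^t)=P_a'^{\,C(t)}$ for $a\in\Sigma$.
   Context: Trees: a tree domain is a non-empty finite prefix-closed $D\subseteq\{0,1\}^\star$ with $u0\in D$ iff $u1\in D$ for all $u\in D$; a tree over $\Sigma$ is a map $t\colon D\to\Sigma$ with $\operatorname{dom}(t)=D$; thickness is $\max_\ell|\operatorname{dom}(t)\cap\{0,1\}^\ell|$, height $h(t)=\max\{|u|:u\in\operatorname{dom}(t)\}$, and $T^K_\Sigma$ is the set of trees of thickness $\le K$. A tree $t$ is regarded as a structure with domain $\operatorname{dom}(t)$, binary relations $S_d^t=\{(u,ud)\}$ ($d=0,1$) and unary $P_a^t=\{u:t(u)=a\}$. A word $w=a_1\cdots a_m$ over an alphabet $\Gamma$ is regarded as the structure with domain $\{1,\dots,m\}$, the natural order $\le$, and unary predicates $P_a=\{i:a_i=a\}$ for $a\in\Gamma$; MSO over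 this signature is monadic second-order logic. Encoding: let $\$$ be a new symbol and $\widehat\Sigma=\Sigma\times\{0,1\}\cup\{\$\}$. For $t\in T^K_\Sigma$ with $m=h(t)$, let $C(t)=\sigma_0\sigma_1\cdots\sigma_m$ where, with $u_{\ell,1},\dots,u_{\ell,s_\ell}$ the lexicographic (with $0<1$) enumeration of $\operatorname{dom}(t)\cap\{0,1\}^\ell$, $c_{\ell,r}=1$ if $u_{\ell,r}0,u_{\ell,r}1\in\operatorname{dom}(t)$ and $c_{\ell,r}=0$ otherwise, $\sigma_\ell=\langle t(u_{\ell,1}),c_{\ell,1}\rangle\cdots\langle t(u_{\ell,s_\ell}),c_{\ell,s_\ell}\rangle\$^{K-s_\ell}\in\widehat\Sigma^K$. -}

module Defs where

open import Data.Nat using (ℕ; zero; suc; _⊔_; _∸_)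
open import Data.Bool using (Bool; true; false)
open import Data.Fin using (Fin)
import Data.Fin as F
open import Data.Fin.Subset using (Subset; _∈_)
open import Data.List using (List; []; _∷_; _++_; map; length; replicate; concatMap; upTo)
import Data.List as L
open import Data.Vec using (Vec; lookup; []; _∷_)
open import Data.Product using (Σ; _×_; _,_; proj₁)
open import Data.Unit using (⊤; tt)
open import Data.Empty using (⊥)
open import Relation.Nullary using (¬_)
open import Relation.Binary.PropositionalEquality using (_≡_)
open import Function.Bundles using (_⇔_)

-- A tree over A with a finite full-binary tree domain
-- D ⊆ {0,1}* (prefix closed, u0 ∈ D iff u1 ∈ D) is represented by the
-- usual inductive full binary tree; its domain is recovered below as
-- the set of addresses u ∈ {0,1}* (lists of Bool, false = 0, true = 1,
-- root first).

data Tree (A : Set) : Set where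
  leaf : A → Tree A
  node : A → Tree A → Tree A → Tree A

_∈D_ : {A : Set} → List Bool → Tree A → Set
[]          ∈D t          = ⊤
(b ∷ u)     ∈D leaf a     = ⊥
(false ∷ u) ∈D node a l r = u ∈D l
(true ∷ u)  ∈D node a l r = u ∈D r

Dom : {A : Set} → Tree A → Set
Dom t = Σ (List Bool) (λ u → u ∈D t)

label : {A : Set} (t : Tree A) (u : List Bool) → u ∈D t → A
label (leaf a)     []          _ = a
label (node a l r) []          _ = a
label (node a l r) (false ∷ u) p = label l u p
label (node a l r) (true ∷ u)  p = label r u p

branching : {A : Set} (t : Tree A) (u : List Bool) → u ∈D t → Bool
branching (leaf a)     []          _ = false
branching (node a l r) []          _ = true
branching (node a l r) (false ∷ u) p = branching l u p
branching (node a l r) (true ∷ u)  p = branching r u p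

level : {A : Set} (t : Tree A) → ℕ → List (Dom t)
level t            zero    = (([] , tt)) ∷ []
level (leaf a)     (suc ℓ) = []
level (node a l r) (suc ℓ) =
  map (λ x → (false ∷ proj₁ x , Data.Product.proj₂ x)) (level l ℓ)
  ++ map (λ x → (true ∷ proj₁ x , Data.Product.proj₂ x)) (level r ℓ)

height : {A : Set} → Tree A → ℕ
height (leaf a)     = 0
height (node a l r) = suc (height l ⊔ height r)

ThicknessAtMost : {A : Set} → ℕ → Tree A → Set
ThicknessAtMost K t = ∀ ℓ → length (level t ℓ) Data.Nat.≤ K

data Hat (A : Set) : Set where
  sym    : A → Bool → Hat A
  dollar : Hat A

block : {A : Set} (K : ℕ) (t : Tree A) → ℕ → List (Hat A)
block K t ℓ =
  map (λ x → sym (label t (proj₁ x) (Data.Product.proj₂ x))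
                 (branching t (proj₁ x) (Data.Product.proj₂ x)))
      (level t ℓ)
  ++ replicate (K ∸ length (level t ℓ)) dollar

C : {A : Set} (K : ℕ) → Tree A → List (Hat A)
C K t = concatMap (block K t) (upTo (suc (height t)))

-- MSO over the word signature (≤, (P_a)_{a ∈ Γ}).
-- Formula Γ n k : formulas whose free first-order variables are among
-- n (de Bruijn) and free second-order variables among k.

data Formula (Γ : Set) : ℕ → ℕ → Set where
  leq  : ∀ {n k} → Fin n → Fin n → Formula Γ n k
  eq   : ∀ {n k} → Fin n → Fin n → Formula Γ n k
  lab  : ∀ {n k} → Γ → Fin n → Formula Γ n k
  mem  : ∀ {n k} → Fin n → Fin k → Formula Γ n k
  neg  : ∀ {n k} → Formula Γ n k → Formula Γ n k
  conj : ∀ {n k} → Formula Γ n k → Formula Γ n k → Formula Γ n k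
  ex1  : ∀ {n k} → Formula Γ (suc n) k → Formula Γ n k
  ex2  : ∀ {n k} → Formula Γ n (suc k) → Formula Γ n k

Pos : {Γ : Set} → List Γ → Set
Pos w = Fin (length w)

Sat : {Γ : Set} (w : List Γ) {n k : ℕ} → Formula Γ n k →
      Vec (Pos w) n → Vec (Subset (length w)) k → Set
Sat w (leq x y)    ρ σ = lookup ρ x F.≤ lookup ρ y
Sat w (eq x y)     ρ σ = lookup ρ x ≡ lookup ρ y
Sat w (lab a x)    ρ σ = L.lookup w (lookup ρ x) ≡ a
Sat w (mem x X)    ρ σ = lookup ρ x ∈ lookup σ X
Sat w (neg φ)      ρ σ = ¬ Sat w φ ρ σ
Sat w (conj φ ψ)   ρ σ = Sat w φ ρ σ × Sat w ψ ρ σ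
Sat w (ex1 φ)      ρ σ = Σ (Pos w) (λ p → Sat w φ (p ∷ ρ) σ)
Sat w (ex2 φ)      ρ σ = Σ (Subset (length w)) (λ X → Sat w φ ρ (X ∷ σ))

record Interp (A : Set) : Set where
  field
    Δ  : Formula (Hat A) 1 0
    S′ : Bool → Formula (Hat A) 2 0
    P′ : A → Formula (Hat A) 1 0

IsMSOInterpretation : {A : Set} (t : Tree A) (w : List (Hat A)) →
                      (Dom t → Pos w) → Interp A → Set
IsMSOInterpretation {A} t w f I =
    (∀ p → Sat w Δ (p ∷ []) [] ⇔ Σ (Dom t) (λ x → f x ≡ p))
  × (∀ (d : Bool) p q → Sat w (S′ d) (p ∷ q ∷ []) []
        ⇔ Σ (Dom t) (λ x → Σ (Dom t) (λ y →
              proj₁ y ≡ proj₁ x ++ (d ∷ []) × f x ≡ p × f y ≡ q)))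
  × (∀ (a : A) p → Sat w (P′ a) (p ∷ []) []
        ⇔ Σ (Dom t) (λ x →
              label t (proj₁ x) (Data.Product.proj₂ x) ≡ a × f x ≡ p))
  where open Interp I

InjectiveOnDom : {A : Set} {B : Set} (t : Tree A) → (Dom t → B) → Set
InjectiveOnDom t f = ∀ x y → f x ≡ f y → proj₁ x ≡ proj₁ y

-- Level ℓ of t occupies the block σ_ℓ of C(t), so a node x is coded by the position
-- depth(x)·K + (rank of x in its level); Δ and P'_a then only inspect the letter at a position.
-- The level ℓ+1 lists the children of the nodes of level ℓ in order, so the d-child of the
-- branching node of rank j in level ℓ has rank 2·#{branching nodes of rank < j} + d in level ℓ+1.
-- As j < K, the branching bits b of those earlier nodes range over the finitely many bit strings
-- of length < K, and S'_d is the disjunction over b of: the block starts at a multiple z of K,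
-- the bits read from z are b, x = z + |b| is branching and y = x + (K ∸ |b|) + 2·#₁(b) + d.
-- Being a multiple of K is MSO-definable: z lies in a set each of whose elements is 0 or K
-- above another element.
module Submission where

open import Defs
open import Data.Bool using (Bool; true; false)
import Data.Bool.Properties as BoolP
open import Data.Bool.Properties using (T-≡)
open import Data.Empty using (⊥-elim)
open import Data.Fin as Fin using (Fin; toℕ; fromℕ<)
import Data.Fin.Properties as FinP
open import Data.Fin.Subset using (Subset) renaming (_∈_ to _∈ₛ_)
open import Data.Fin.Subset.Properties using (_∈?_; anySubset?)
open import Data.List as List using (List; []; _∷_; _++_; length; map; replicate; concatMap; take; applyUpTo; upTo; allFin)
import Data.List.Properties as ListP
open import Data.List.Membership.Propositional using () renaming (_∈_ to _∈ₗ_)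
open import Data.List.Membership.Propositional.Properties
  using (∈-map⁺; ∈-map⁻; ∈-++⁺ˡ; ∈-++⁺ʳ; ∈-++⁻; ∈-allFin)
open import Data.List.Relation.Unary.Any using (here; there)
open import Data.Maybe using (Maybe; just; nothing)
open import Data.Nat as ℕ using (ℕ; zero; suc; _+_; _*_; _∸_; _≤_; _<_; z≤n; s≤s; _%_; _/_; NonZero)
import Data.Nat.Properties as ℕP
open import Data.Nat.DivMod using (m≡m%n+[m/n]*n; [m+kn]%n≡m%n; m<n⇒m%n≡m; m%n<n; m<n*o⇒m/o<n)
open import Data.Nat.Divisibility using (_∣_; divides; _∣?_; _∣0; n∣n; ∣m∣n⇒∣m+n)
open import Data.Nat.Tactic.RingSolver using (solve-∀)
import Data.Product
open import Data.Product using (Σ; _×_; _,_; proj₁; proj₂)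
import Data.Sum
open import Data.Sum using (_⊎_; inj₁; inj₂)
open import Data.Unit using (⊤; tt)
open import Data.Vec as Vec using (Vec; lookup; []; _∷_)
open import Data.Vec.Properties using (lookup∘tabulate; []=⇒lookup; lookup⇒[]=)
open import Function using (_∘_; id)
open import Function.Bundles using (Equivalence; _⇔_; mk⇔)
open import Relation.Binary.Definitions using (DecidableEquality)
open import Relation.Binary.PropositionalEquality as ≡ using (_≡_; refl; cong; cong₂; trans; subst; subst₂)
open import Relation.Nullary using (¬_; Dec; yes; no)
open import Relation.Nullary.Decidable using (¬?; _×-dec_; ⌊_⌋; toWitness; fromWitness)

module _ {A : Set} where

  at : List A → ℕ → Maybe A
  at []       n       = nothing
  at (x ∷ xs) zero    = just x
  at (x ∷ xs) (suc n) = at xs n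

  at-lookup : (xs : List A) (i : Fin (length xs)) → at xs (toℕ i) ≡ just (List.lookup xs i)
  at-lookup (x ∷ xs) Fin.zero    = refl
  at-lookup (x ∷ xs) (Fin.suc i) = at-lookup xs i

  at⇒< : ∀ xs n {x} → at xs n ≡ just x → n < length xs
  at⇒< (x ∷ xs) zero    e = s≤s z≤n
  at⇒< (x ∷ xs) (suc n) e = s≤s (at⇒< xs n e)

  at≡nothing⇒≤ : ∀ xs n → at xs n ≡ nothing → length xs ≤ n
  at≡nothing⇒≤ []       n       e = z≤n
  at≡nothing⇒≤ (x ∷ xs) (suc n) e = s≤s (at≡nothing⇒≤ xs n e)

  at-++ˡ : ∀ xs ys n → n < length xs → at (xs ++ ys) n ≡ at xs n
  at-++ˡ (x ∷ xs) ys zero    _       = refl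
  at-++ˡ (x ∷ xs) ys (suc n) (s≤s l) = at-++ˡ xs ys n l

  at-++ʳ : ∀ xs ys n → at (xs ++ ys) (length xs + n) ≡ at ys n
  at-++ʳ []       ys n = refl
  at-++ʳ (x ∷ xs) ys n = at-++ʳ xs ys n

  at-++⁻ : ∀ xs ys n {y} → at (xs ++ ys) n ≡ just y →
           at xs n ≡ just y ⊎ Σ ℕ (λ m → n ≡ length xs + m × at ys m ≡ just y)
  at-++⁻ []       ys n       e = inj₂ (n , refl , e)
  at-++⁻ (x ∷ xs) ys zero    e = inj₁ e
  at-++⁻ (x ∷ xs) ys (suc n) e with at-++⁻ xs ys n e
  ... | inj₁ e′             = inj₁ e′
  ... | inj₂ (m , refl , e′) = inj₂ (m , refl , e′)

  at-replicate : ∀ m n (a : A) → n < m → at (replicate m a) n ≡ just a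
  at-replicate (suc m) zero    a _       = refl
  at-replicate (suc m) (suc n) a (s≤s l) = at-replicate m n a l

module _ {A B : Set} (f : A → B) where

  at-map : ∀ xs n {x} → at xs n ≡ just x → at (map f xs) n ≡ just (f x)
  at-map (x ∷ xs) zero    refl = refl
  at-map (x ∷ xs) (suc n) e    = at-map xs n e

  at-map⁻ : ∀ xs n {y} → at (map f xs) n ≡ just y → Σ A (λ x → at xs n ≡ just x × y ≡ f x)
  at-map⁻ (x ∷ xs) zero    refl = x , refl , refl
  at-map⁻ (x ∷ xs) (suc n) e    = at-map⁻ xs n e

at-applyUpTo : ∀ {B : Set} (f : ℕ → B) n ℓ → ℓ < n → at (applyUpTo f n) ℓ ≡ just (f ℓ)
at-applyUpTo f (suc n) zero    _         = refl
at-applyUpTo f (suc n) (suc ℓ) (s≤s ℓ<n) = at-applyUpTo (f ∘ suc) n ℓ ℓ<n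

just-injective : {A : Set} {x y : A} → just x ≡ just y → x ≡ y
just-injective refl = refl

module _ (K : ℕ) .{{_ : NonZero K}} where

  quotient-remainder-unique : ∀ {ℓ ℓ′ j j′} → j < K → j′ < K →
                              ℓ * K + j ≡ ℓ′ * K + j′ → ℓ ≡ ℓ′ × j ≡ j′
  quotient-remainder-unique {ℓ} {ℓ′} {j} {j′} j<K j′<K e = ℓ≡ℓ′ , j≡j′
    where
    remainder : ∀ ℓ j → j < K → (ℓ * K + j) % K ≡ j
    remainder ℓ j j<K = trans (cong (_% K) (ℕP.+-comm (ℓ * K) j)) (trans ([m+kn]%n≡m%n j ℓ K) (m<n⇒m%n≡m j<K))
    j≡j′ : j ≡ j′
    j≡j′ = trans (≡.sym (remainder ℓ j j<K)) (trans (cong (_% K) e) (remainder ℓ′ j′ j′<K))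
    ℓ≡ℓ′ : ℓ ≡ ℓ′
    ℓ≡ℓ′ = ℕP.*-cancelʳ-≡ ℓ ℓ′ K
             (ℕP.+-cancelʳ-≡ j (ℓ * K) (ℓ′ * K) (trans e (cong (ℓ′ * K +_) (≡.sym j≡j′))))

  quotient-remainder : ∀ P h → P < h * K → Σ ℕ λ ℓ → Σ ℕ λ j → ℓ < h × j < K × P ≡ ℓ * K + j
  quotient-remainder P h P<hK =
    P / K , P % K , m<n*o⇒m/o<n P<hK , m%n<n P K , trans (m≡m%n+[m/n]*n P K) (ℕP.+-comm (P % K) _)

next-block-position : ∀ K ℓ j i → j ≤ K → suc ℓ * K + i ≡ ℓ * K + j + (K ∸ j + i)
next-block-position K ℓ j i j≤K =
  trans (cong (λ k → k + ℓ * K + i) (≡.sym (ℕP.m+[n∸m]≡n j≤K))) (regroup (ℓ * K) j (K ∸ j) i)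
  where
  regroup : ∀ a j e i → j + e + a + i ≡ a + j + (e + i)
  regroup = solve-∀

module _ {B C : Set} (K : ℕ) (g : B → List C) (length-g : ∀ b → length (g b) ≡ K) where

  length-concatMap-uniform : ∀ bs → length (concatMap g bs) ≡ length bs * K
  length-concatMap-uniform []       = refl
  length-concatMap-uniform (b ∷ bs) =
    trans (ListP.length-++ (g b)) (cong₂ _+_ (length-g b) (length-concatMap-uniform bs))

  at-concatMap-uniform : ∀ bs ℓ j {b} → at bs ℓ ≡ just b → j < K →
                         at (concatMap g bs) (ℓ * K + j) ≡ at (g b) j
  at-concatMap-uniform (b ∷ bs) zero j refl j<K =
    at-++ˡ (g b) (concatMap g bs) j (subst (j <_) (≡.sym (length-g b)) j<K)
  at-concatMap-uniform (b′ ∷ bs) (suc ℓ) j {b} e j<K = begin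
    at (g b′ ++ concatMap g bs) (K + ℓ * K + j)
      ≡⟨ cong (at (g b′ ++ concatMap g bs))
              (trans (ℕP.+-assoc K (ℓ * K) j) (cong (_+ (ℓ * K + j)) (≡.sym (length-g b′)))) ⟩
    at (g b′ ++ concatMap g bs) (length (g b′) + (ℓ * K + j))
      ≡⟨ at-++ʳ (g b′) (concatMap g bs) (ℓ * K + j) ⟩
    at (concatMap g bs) (ℓ * K + j)
      ≡⟨ at-concatMap-uniform bs ℓ j e j<K ⟩
    at (g b) j ∎
    where open ≡.≡-Reasoning

-- Derived MSO formulas over words

module _ {Γ : Set} where

  private variable n k : ℕ

  ⊥F : Formula Γ n k
  ⊥F = ex1 (neg (eq Fin.zero Fin.zero))

  _∨F_ : Formula Γ n k → Formula Γ n k → Formula Γ n k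
  φ ∨F ψ = neg (conj (neg φ) (neg ψ))

  _⇒F_ : Formula Γ n k → Formula Γ n k → Formula Γ n k
  φ ⇒F ψ = neg (conj φ (neg ψ))

  ∀F : Formula Γ (suc n) k → Formula Γ n k
  ∀F φ = neg (ex1 (neg φ))

  ⋁F : ∀ {B : Set} → (B → Formula Γ n k) → List B → Formula Γ n k
  ⋁F φ []       = ⊥F
  ⋁F φ (b ∷ bs) = φ b ∨F ⋁F φ bs

  _<F_ : Fin n → Fin n → Formula Γ n k
  x <F y = conj (leq x y) (neg (eq x y))

  SuccF : Fin n → Fin n → Formula Γ n k
  SuccF x y = conj (x <F y) (neg (ex1 (conj (Fin.suc x <F Fin.zero) (Fin.zero <F Fin.suc y))))

  OffsetF : ℕ → Fin n → Fin n → Formula Γ n k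
  OffsetF zero    x y = eq x y
  OffsetF (suc m) x y = ex1 (conj (SuccF (Fin.suc x) Fin.zero) (OffsetF m Fin.zero (Fin.suc y)))

  FirstF : Fin n → Formula Γ n k
  FirstF x = ∀F (leq (Fin.suc x) Fin.zero)

  PredecessorInF : ℕ → Fin k → Formula Γ (suc n) k
  PredecessorInF K X = ex1 (conj (mem Fin.zero X) (OffsetF K Fin.zero (Fin.suc Fin.zero)))

  -- Every element of X is 0 or K above an element of X; for K = 0 every X qualifies.
  StepsFromZeroF : ℕ → Fin k → Formula Γ n k
  StepsFromZeroF K X = ∀F (mem Fin.zero X ⇒F (FirstF Fin.zero ∨F PredecessorInF K X))

  MultipleF : ℕ → Fin n → Formula Γ n k
  MultipleF K x = ex2 (conj (mem x Fin.zero) (StepsFromZeroF K Fin.zero))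

module MSO {Γ : Set} (_≟_ : DecidableEquality Γ) (w : List Γ) where

  private variable n k : ℕ

  N : ℕ
  N = length w

  ⟦_⟧ : Fin n → Vec (Pos w) n → ℕ
  ⟦ x ⟧ ρ = toℕ (lookup ρ x)

  positionBelow : ∀ m (p : Pos w) → m ≤ toℕ p → Σ (Pos w) λ q → toℕ q ≡ m
  positionBelow m p m≤p = fromℕ< m<N , FinP.toℕ-fromℕ< m<N
    where m<N = ℕP.≤-<-trans m≤p (FinP.toℕ<n p)

  -- Satisfaction in a finite word is decidable, which makes the classical ∨F, ⇒F and ∀F usable.
  sat? : ∀ (φ : Formula Γ n k) ρ σ → Dec (Sat w φ ρ σ)
  sat? (leq x y)  ρ σ = lookup ρ x Fin.≤? lookup ρ y
  sat? (eq x y)   ρ σ = lookup ρ x Fin.≟ lookup ρ y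
  sat? (lab a x)  ρ σ = List.lookup w (lookup ρ x) ≟ a
  sat? (mem x X)  ρ σ = lookup ρ x ∈? lookup σ X
  sat? (neg φ)    ρ σ = ¬? (sat? φ ρ σ)
  sat? (conj φ ψ) ρ σ = sat? φ ρ σ ×-dec sat? ψ ρ σ
  sat? (ex1 φ)    ρ σ = FinP.any? (λ p → sat? φ (p ∷ ρ) σ)
  sat? (ex2 φ)    ρ σ = anySubset? (λ X → sat? φ ρ (X ∷ σ))

  sat-stable : ∀ (φ : Formula Γ n k) ρ σ → ¬ ¬ Sat w φ ρ σ → Sat w φ ρ σ
  sat-stable φ ρ σ ¬¬s with sat? φ ρ σ
  ... | yes s = s
  ... | no ¬s = ⊥-elim (¬¬s ¬s)

  sat-lab⁻ : ∀ a (x : Fin n) ρ (σ : Vec (Subset N) k) → Sat w (lab a x) ρ σ → at w (⟦ x ⟧ ρ) ≡ just a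
  sat-lab⁻ a x ρ σ s = trans (at-lookup w (lookup ρ x)) (cong just s)

  sat-lab⁺ : ∀ a (x : Fin n) ρ (σ : Vec (Subset N) k) → at w (⟦ x ⟧ ρ) ≡ just a → Sat w (lab a x) ρ σ
  sat-lab⁺ a x ρ σ e = just-injective (trans (≡.sym (at-lookup w (lookup ρ x))) e)

  sat-∨⁻ : ∀ (φ ψ : Formula Γ n k) ρ σ → Sat w (φ ∨F ψ) ρ σ → Sat w φ ρ σ ⊎ Sat w ψ ρ σ
  sat-∨⁻ φ ψ ρ σ s with sat? φ ρ σ
  ... | yes sφ = inj₁ sφ
  ... | no ¬sφ = inj₂ (sat-stable ψ ρ σ (λ ¬sψ → s (¬sφ , ¬sψ)))

  sat-∨⁺ˡ : ∀ (φ ψ : Formula Γ n k) ρ σ → Sat w φ ρ σ → Sat w (φ ∨F ψ) ρ σ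
  sat-∨⁺ˡ φ ψ ρ σ sφ (¬sφ , _) = ¬sφ sφ

  sat-∨⁺ʳ : ∀ (φ ψ : Formula Γ n k) ρ σ → Sat w ψ ρ σ → Sat w (φ ∨F ψ) ρ σ
  sat-∨⁺ʳ φ ψ ρ σ sψ (_ , ¬sψ) = ¬sψ sψ

  sat-⇒⁻ : ∀ (φ ψ : Formula Γ n k) ρ σ → Sat w (φ ⇒F ψ) ρ σ → Sat w φ ρ σ → Sat w ψ ρ σ
  sat-⇒⁻ φ ψ ρ σ s sφ = sat-stable ψ ρ σ (λ ¬sψ → s (sφ , ¬sψ))

  sat-⇒⁺ : ∀ (φ ψ : Formula Γ n k) ρ σ → (Sat w φ ρ σ → Sat w ψ ρ σ) → Sat w (φ ⇒F ψ) ρ σ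
  sat-⇒⁺ φ ψ ρ σ h (sφ , ¬sψ) = ¬sψ (h sφ)

  sat-∀⁻ : ∀ (φ : Formula Γ (suc n) k) ρ σ → Sat w (∀F φ) ρ σ → ∀ p → Sat w φ (p ∷ ρ) σ
  sat-∀⁻ φ ρ σ s p = sat-stable φ (p ∷ ρ) σ (λ ¬sφ → s (p , ¬sφ))

  sat-∀⁺ : ∀ (φ : Formula Γ (suc n) k) ρ σ → (∀ p → Sat w φ (p ∷ ρ) σ) → Sat w (∀F φ) ρ σ
  sat-∀⁺ φ ρ σ h (p , ¬sφ) = ¬sφ (h p)

  sat-⋁⁻ : ∀ {B : Set} (φ : B → Formula Γ n k) bs ρ σ →
           Sat w (⋁F φ bs) ρ σ → Σ B λ b → b ∈ₗ bs × Sat w (φ b) ρ σ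
  sat-⋁⁻ φ []       ρ σ (_ , p≢p) = ⊥-elim (p≢p refl)
  sat-⋁⁻ φ (b ∷ bs) ρ σ s with sat-∨⁻ (φ b) (⋁F φ bs) ρ σ s
  ... | inj₁ sb = b , here refl , sb
  ... | inj₂ s′ with sat-⋁⁻ φ bs ρ σ s′
  ...   | c , c∈bs , sc = c , there c∈bs , sc

  sat-⋁⁺ : ∀ {B : Set} (φ : B → Formula Γ n k) bs ρ σ {b} →
           b ∈ₗ bs → Sat w (φ b) ρ σ → Sat w (⋁F φ bs) ρ σ
  sat-⋁⁺ φ (b ∷ bs) ρ σ (here refl) sb = sat-∨⁺ˡ (φ b) (⋁F φ bs) ρ σ sb
  sat-⋁⁺ φ (c ∷ bs) ρ σ (there b∈bs) sb = sat-∨⁺ʳ (φ c) (⋁F φ bs) ρ σ (sat-⋁⁺ φ bs ρ σ b∈bs sb)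

  sat-<⁻ : ∀ (x y : Fin n) ρ (σ : Vec (Subset N) k) → Sat w (x <F y) ρ σ → ⟦ x ⟧ ρ < ⟦ y ⟧ ρ
  sat-<⁻ x y ρ σ (x≤y , x≢y) = ℕP.≤∧≢⇒< x≤y (λ e → x≢y (FinP.toℕ-injective e))

  sat-<⁺ : ∀ (x y : Fin n) ρ (σ : Vec (Subset N) k) → ⟦ x ⟧ ρ < ⟦ y ⟧ ρ → Sat w (x <F y) ρ σ
  sat-<⁺ x y ρ σ x<y = ℕP.<⇒≤ x<y , λ e → ℕP.<⇒≢ x<y (cong toℕ e)

  sat-succ⁻ : ∀ (x y : Fin n) ρ (σ : Vec (Subset N) k) →
              Sat w (SuccF x y) ρ σ → ⟦ y ⟧ ρ ≡ suc (⟦ x ⟧ ρ)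
  sat-succ⁻ x y ρ σ (x<y , nothing-between) with ℕP.m≤n⇒m<n∨m≡n (sat-<⁻ x y ρ σ x<y)
  ... | inj₂ e = ≡.sym e
  ... | inj₁ 1+x<y =
    let (z , z≡1+x) = positionBelow (suc (⟦ x ⟧ ρ)) (lookup ρ y) (ℕP.<⇒≤ 1+x<y)
    in ⊥-elim (nothing-between (z ,
         sat-<⁺ (Fin.suc x) Fin.zero (z ∷ ρ) σ (subst (⟦ x ⟧ ρ <_) (≡.sym z≡1+x) (ℕP.n<1+n _)) ,
         sat-<⁺ Fin.zero (Fin.suc y) (z ∷ ρ) σ (subst (_< ⟦ y ⟧ ρ) (≡.sym z≡1+x) 1+x<y)))

  sat-succ⁺ : ∀ (x y : Fin n) ρ (σ : Vec (Subset N) k) →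
              ⟦ y ⟧ ρ ≡ suc (⟦ x ⟧ ρ) → Sat w (SuccF x y) ρ σ
  sat-succ⁺ x y ρ σ e = sat-<⁺ x y ρ σ (ℕP.≤-reflexive (≡.sym e)) , λ where
    (z , x<z , z<y) → ℕP.<-irrefl refl (ℕP.<-≤-trans (sat-<⁻ (Fin.suc x) Fin.zero (z ∷ ρ) σ x<z)
                        (ℕP.≤-pred (subst (toℕ z <_) e (sat-<⁻ Fin.zero (Fin.suc y) (z ∷ ρ) σ z<y))))

  sat-first⁻ : ∀ (x : Fin n) ρ (σ : Vec (Subset N) k) → Sat w (FirstF x) ρ σ → ⟦ x ⟧ ρ ≡ 0
  sat-first⁻ x ρ σ s =
    let (z , z≡0) = positionBelow 0 (lookup ρ x) z≤n
    in ℕP.n≤0⇒n≡0 (subst (⟦ x ⟧ ρ ≤_) z≡0 (sat-∀⁻ (leq (Fin.suc x) Fin.zero) ρ σ s z))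

  sat-first⁺ : ∀ (x : Fin n) ρ (σ : Vec (Subset N) k) → ⟦ x ⟧ ρ ≡ 0 → Sat w (FirstF x) ρ σ
  sat-first⁺ x ρ σ e = sat-∀⁺ (leq (Fin.suc x) Fin.zero) ρ σ (λ p → subst (_≤ toℕ p) (≡.sym e) z≤n)

  sat-offset⁻ : ∀ m (x y : Fin n) ρ (σ : Vec (Subset N) k) →
                Sat w (OffsetF m x y) ρ σ → ⟦ y ⟧ ρ ≡ ⟦ x ⟧ ρ + m
  sat-offset⁻ zero    x y ρ σ x≡y = trans (cong toℕ (≡.sym x≡y)) (≡.sym (ℕP.+-identityʳ _))
  sat-offset⁻ (suc m) x y ρ σ (z , z≡1+x , y≡z+m) = begin
    ⟦ y ⟧ ρ          ≡⟨ sat-offset⁻ m Fin.zero (Fin.suc y) (z ∷ ρ) σ y≡z+m ⟩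
    toℕ z + m        ≡⟨ cong (_+ m) (sat-succ⁻ (Fin.suc x) Fin.zero (z ∷ ρ) σ z≡1+x) ⟩
    suc (⟦ x ⟧ ρ + m) ≡⟨ ℕP.+-suc _ m ⟨
    ⟦ x ⟧ ρ + suc m  ∎
    where open ≡.≡-Reasoning

  sat-offset⁺ : ∀ m (x y : Fin n) ρ (σ : Vec (Subset N) k) →
                ⟦ y ⟧ ρ ≡ ⟦ x ⟧ ρ + m → Sat w (OffsetF m x y) ρ σ
  sat-offset⁺ zero    x y ρ σ e = FinP.toℕ-injective (trans (≡.sym (ℕP.+-identityʳ _)) (≡.sym e))
  sat-offset⁺ (suc m) x y ρ σ e =
    z , sat-succ⁺ (Fin.suc x) Fin.zero (z ∷ ρ) σ z≡1+x ,
        sat-offset⁺ m Fin.zero (Fin.suc y) (z ∷ ρ) σ (trans e (trans (ℕP.+-suc _ m) (cong (_+ m) (≡.sym z≡1+x))))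
    where
    open Σ (positionBelow (suc (⟦ x ⟧ ρ)) (lookup ρ y)
                          (subst (suc (⟦ x ⟧ ρ) ≤_) (≡.sym e) (ℕP.m<m+n _ (s≤s z≤n))))
      renaming (proj₁ to z; proj₂ to z≡1+x)

  module _ (K : ℕ) .{{_ : NonZero K}} where

    stepsFromZero⇒∣ : ∀ {n k} (X : Fin k) (ρ : Vec (Pos w) n) σ → Sat w (StepsFromZeroF K X) ρ σ →
                      ∀ p → p ∈ₛ lookup σ X → K ∣ toℕ p
    stepsFromZero⇒∣ {n} {k} X ρ σ s p = go (suc (toℕ p)) p (ℕP.n<1+n _)
      where
      reached : Formula Γ (suc n) k
      reached = FirstF Fin.zero ∨F PredecessorInF K X

      go : ∀ fuel (p : Pos w) → toℕ p < fuel → p ∈ₛ lookup σ X → K ∣ toℕ p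
      go (suc fuel) p p<fuel p∈X
        with sat-∨⁻ (FirstF Fin.zero) (PredecessorInF K X) (p ∷ ρ) σ
               (sat-⇒⁻ (mem Fin.zero X) reached (p ∷ ρ) σ (sat-∀⁻ (mem Fin.zero X ⇒F reached) ρ σ s p) p∈X)
      ... | inj₁ p-first rewrite sat-first⁻ Fin.zero (p ∷ ρ) σ p-first = K ∣0
      ... | inj₂ (v , v∈X , p≡v+K) =
        let p≡v+K′ = sat-offset⁻ K Fin.zero (Fin.suc Fin.zero) (v ∷ p ∷ ρ) σ p≡v+K
            v<fuel = ℕP.<-≤-trans (subst (toℕ v <_) (≡.sym p≡v+K′) (ℕP.m<m+n (toℕ v) (ℕ.>-nonZero⁻¹ K)))
                                  (ℕP.≤-pred p<fuel)
        in subst (K ∣_) (≡.sym p≡v+K′) (∣m∣n⇒∣m+n (go fuel v v<fuel v∈X) n∣n)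

    multiples : Subset N
    multiples = Vec.tabulate (λ i → ⌊ K ∣? toℕ i ⌋)

    ∈-multiples⁻ : ∀ p → p ∈ₛ multiples → K ∣ toℕ p
    ∈-multiples⁻ p p∈ =
      toWitness (Equivalence.from T-≡ (trans (≡.sym (lookup∘tabulate _ p)) ([]=⇒lookup p∈)))

    ∈-multiples⁺ : ∀ p → K ∣ toℕ p → p ∈ₛ multiples
    ∈-multiples⁺ p K∣p =
      lookup⇒[]= p multiples (trans (lookup∘tabulate _ p) (Equivalence.to T-≡ (fromWitness K∣p)))

    sat-multiple⁻ : ∀ (x : Fin n) ρ (σ : Vec (Subset N) k) → Sat w (MultipleF K x) ρ σ → K ∣ ⟦ x ⟧ ρ
    sat-multiple⁻ x ρ σ (X , x∈X , steps) = stepsFromZero⇒∣ Fin.zero ρ (X ∷ σ) steps (lookup ρ x) x∈X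

    sat-multiple⁺ : ∀ (x : Fin n) ρ (σ : Vec (Subset N) k) → K ∣ ⟦ x ⟧ ρ → Sat w (MultipleF K x) ρ σ
    sat-multiple⁺ {n} {k} x ρ σ K∣x =
      multiples , ∈-multiples⁺ (lookup ρ x) K∣x ,
      sat-∀⁺ (mem Fin.zero Fin.zero ⇒F reached) ρ (multiples ∷ σ) λ p →
        sat-⇒⁺ (mem Fin.zero Fin.zero) reached (p ∷ ρ) (multiples ∷ σ) λ p∈ →
          reachedFrom p (∈-multiples⁻ p p∈)
      where
      reached : Formula Γ (suc n) (suc k)
      reached = FirstF Fin.zero ∨F PredecessorInF K Fin.zero

      reachedFrom : ∀ p → K ∣ toℕ p → Sat w reached (p ∷ ρ) (multiples ∷ σ)
      reachedFrom p (divides zero p≡0) =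
        sat-∨⁺ˡ (FirstF Fin.zero) (PredecessorInF K Fin.zero) (p ∷ ρ) (multiples ∷ σ)
          (sat-first⁺ Fin.zero (p ∷ ρ) (multiples ∷ σ) p≡0)
      reachedFrom p (divides (suc q) p≡[1+q]K) =
        let (v , v≡qK) = positionBelow (q * K) p (subst (q * K ≤_) (≡.sym p≡[1+q]K) (ℕP.m≤n+m (q * K) K))
        in sat-∨⁺ʳ (FirstF Fin.zero) (PredecessorInF K Fin.zero) (p ∷ ρ) (multiples ∷ σ)
             (v , ∈-multiples⁺ v (divides q v≡qK) ,
              sat-offset⁺ K Fin.zero (Fin.suc Fin.zero) (v ∷ p ∷ ρ) (multiples ∷ σ)
                (trans p≡[1+q]K (trans (ℕP.+-comm K (q * K)) (cong (_+ K) (≡.sym v≡qK)))))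

-- Formulas reading the branching bits of the encoding

module _ {A : Set} where

  -- $ and positions past the end of the word read as 0.
  branchBit : Maybe (Hat A) → Bool
  branchBit (just (sym _ c)) = c
  branchBit _                = false

  bitAt : List (Hat A) → ℕ → Bool
  bitAt w n = branchBit (at w n)

  ≢dollar⇒sym : ∀ (s : Hat A) → ¬ s ≡ dollar → Σ A λ a → Σ Bool λ c → s ≡ sym a c
  ≢dollar⇒sym (sym a c) _       = a , c , refl
  ≢dollar⇒sym dollar    s≢dollar = ⊥-elim (s≢dollar refl)

  branchBit≡true : ∀ s → branchBit s ≡ true → Σ A λ a → s ≡ just (sym a true)
  branchBit≡true (just (sym a true)) _ = a , refl

  MatchesAt : List (Hat A) → ℕ → List Bool → Set
  MatchesAt w n []      = ⊤
  MatchesAt w n (c ∷ b) = bitAt w n ≡ c × MatchesAt w (suc n) b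

  module _ (_≟A_ : DecidableEquality A) where

    _≟Hat_ : DecidableEquality (Hat A)
    sym a c ≟Hat sym a′ c′ with a ≟A a′ | c BoolP.≟ c′
    ... | yes refl | yes refl = yes refl
    ... | no a≢a′  | _        = no λ { refl → a≢a′ refl }
    ... | yes _    | no c≢c′  = no λ { refl → c≢c′ refl }
    sym a c ≟Hat dollar  = no λ ()
    dollar  ≟Hat sym a c = no λ ()
    dollar  ≟Hat dollar  = yes refl

childCount : List Bool → ℕ
childCount []          = 0
childCount (true ∷ b)  = suc (suc (childCount b))
childCount (false ∷ b) = childCount b

bitToℕ : Bool → ℕ
bitToℕ false = 0
bitToℕ true  = 1

childOffset : ℕ → Bool → List Bool → ℕ
childOffset K d b = K ∸ length b + (childCount b + bitToℕ d)

bitStrings : ℕ → List (List Bool)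
bitStrings zero    = [] ∷ []
bitStrings (suc n) = map (false ∷_) (bitStrings n) ++ map (true ∷_) (bitStrings n)

shortBitStrings : ℕ → List (List Bool)
shortBitStrings zero    = []
shortBitStrings (suc n) = bitStrings n ++ shortBitStrings n

∈-bitStrings⁻ : ∀ n {b} → b ∈ₗ bitStrings n → length b ≡ n
∈-bitStrings⁻ zero    (here refl) = refl
∈-bitStrings⁻ (suc n) b∈ with ∈-++⁻ (map (false ∷_) (bitStrings n)) b∈
... | inj₁ b∈₀ with ∈-map⁻ (false ∷_) b∈₀
...   | c , c∈ , refl = cong suc (∈-bitStrings⁻ n c∈)
∈-bitStrings⁻ (suc n) b∈ | inj₂ b∈₁ with ∈-map⁻ (true ∷_) b∈₁
...   | c , c∈ , refl = cong suc (∈-bitStrings⁻ n c∈)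

∈-bitStrings⁺ : ∀ b → b ∈ₗ bitStrings (length b)
∈-bitStrings⁺ []          = here refl
∈-bitStrings⁺ (false ∷ b) = ∈-++⁺ˡ (∈-map⁺ (false ∷_) (∈-bitStrings⁺ b))
∈-bitStrings⁺ (true ∷ b)  =
  ∈-++⁺ʳ (map (false ∷_) (bitStrings (length b))) (∈-map⁺ (true ∷_) (∈-bitStrings⁺ b))

∈-shortBitStrings⁻ : ∀ n {b} → b ∈ₗ shortBitStrings n → length b < n
∈-shortBitStrings⁻ (suc n) b∈ with ∈-++⁻ (bitStrings n) b∈
... | inj₁ b∈ₙ = s≤s (ℕP.≤-reflexive (∈-bitStrings⁻ n b∈ₙ))
... | inj₂ b∈< = ℕP.m≤n⇒m≤1+n (∈-shortBitStrings⁻ n b∈<)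

∈-shortBitStrings⁺ : ∀ n b → length b < n → b ∈ₗ shortBitStrings n
∈-shortBitStrings⁺ (suc n) b (s≤s b≤n) with ℕP.m≤n⇒m<n∨m≡n b≤n
... | inj₁ b<n  = ∈-++⁺ʳ (bitStrings n) (∈-shortBitStrings⁺ n b b<n)
... | inj₂ refl = ∈-++⁺ˡ (∈-bitStrings⁺ b)

module _ {A : Set} (w : List (Hat A)) where

  matchesAt-pointwise : ∀ n bs → (∀ r {c} → at bs r ≡ just c → bitAt w (n + r) ≡ c) → MatchesAt w n bs
  matchesAt-pointwise n []       _  = tt
  matchesAt-pointwise n (c ∷ bs) pw =
    subst (λ m → bitAt w m ≡ c) (ℕP.+-identityʳ n) (pw 0 refl) ,
    matchesAt-pointwise (suc n) bs (λ r {c′} e → subst (λ m → bitAt w m ≡ c′) (ℕP.+-suc n r) (pw (suc r) e))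

  matchesAt-take : ∀ n bs → MatchesAt w n bs → ∀ j → MatchesAt w n (take j bs)
  matchesAt-take n bs       _          zero    = tt
  matchesAt-take n []       _          (suc j) = tt
  matchesAt-take n (c ∷ bs) (bit , m)  (suc j) = bit , matchesAt-take (suc n) bs m j

  matchesAt-unique : ∀ n bs b → MatchesAt w n bs → MatchesAt w n b →
                     length b ≤ length bs → b ≡ take (length b) bs
  matchesAt-unique n bs       []      _          _          _       = refl
  matchesAt-unique n (c ∷ bs) (c′ ∷ b) (bit , m) (bit′ , m′) (s≤s l) =
    cong₂ _∷_ (trans (≡.sym bit′) bit) (matchesAt-unique (suc n) bs b m m′ l)

  module _ (K : ℕ) where

    ChildSpec : Bool → ℕ → ℕ → Set
    ChildSpec d P Q = Σ ℕ λ ℓ → Σ (List Bool) λ b →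
      length b < K × P ≡ ℓ * K + length b × MatchesAt w (ℓ * K) b ×
      bitAt w P ≡ true × Q ≡ P + childOffset K d b

module BranchFormulas {A : Set} (elements : List A) where

  private variable n k : ℕ

  BranchF : Fin n → Formula (Hat A) n k
  BranchF x = ⋁F (λ a → lab (sym a true) x) elements

  BitF : Bool → Fin n → Formula (Hat A) n k
  BitF true  x = BranchF x
  BitF false x = neg (BranchF x)

  PatternF : List Bool → Fin n → Fin n → Formula (Hat A) n k
  PatternF []      z x = eq z x
  PatternF (c ∷ b) z x = conj (BitF c z) (ex1 (conj (SuccF (Fin.suc z) Fin.zero) (PatternF b Fin.zero (Fin.suc x))))

  -- Free variables: 0 is the start of the block containing 1, and 2 is its child.
  ChildPatternF : ℕ → Bool → List Bool → Formula (Hat A) 3 0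
  ChildPatternF K d b = conj (PatternF b Fin.zero (Fin.suc Fin.zero))
    (conj (BranchF (Fin.suc Fin.zero)) (OffsetF (childOffset K d b) (Fin.suc Fin.zero) (Fin.suc (Fin.suc Fin.zero))))

  ChildF : ℕ → Bool → Formula (Hat A) 2 0
  ChildF K d = ex1 (conj (MultipleF K Fin.zero) (⋁F (ChildPatternF K d) (shortBitStrings K)))

module BranchSemantics {A : Set} (_≟A_ : DecidableEquality A)
                 (elements : List A) (complete : ∀ a → a ∈ₗ elements)
                 (w : List (Hat A)) where

  open MSO (_≟Hat_ _≟A_) w
  open BranchFormulas elements

  private variable n k : ℕ

  sat-branch⁻ : ∀ (x : Fin n) ρ (σ : Vec (Subset N) k) → Sat w (BranchF x) ρ σ → bitAt w (⟦ x ⟧ ρ) ≡ true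
  sat-branch⁻ x ρ σ s with sat-⋁⁻ (λ a → lab (sym a true) x) elements ρ σ s
  ... | a , _ , sa rewrite sat-lab⁻ (sym a true) x ρ σ sa = refl

  sat-branch⁺ : ∀ (x : Fin n) ρ (σ : Vec (Subset N) k) → bitAt w (⟦ x ⟧ ρ) ≡ true → Sat w (BranchF x) ρ σ
  sat-branch⁺ x ρ σ e with branchBit≡true (at w (⟦ x ⟧ ρ)) e
  ... | a , at≡a =
    sat-⋁⁺ (λ a → lab (sym a true) x) elements ρ σ (complete a) (sat-lab⁺ (sym a true) x ρ σ at≡a)

  sat-bit⁻ : ∀ c (x : Fin n) ρ (σ : Vec (Subset N) k) → Sat w (BitF c x) ρ σ → bitAt w (⟦ x ⟧ ρ) ≡ c
  sat-bit⁻ true  x ρ σ s = sat-branch⁻ x ρ σ s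
  sat-bit⁻ false x ρ σ s with bitAt w (⟦ x ⟧ ρ) in e
  ... | false = refl
  ... | true  = ⊥-elim (s (sat-branch⁺ x ρ σ e))

  sat-bit⁺ : ∀ c (x : Fin n) ρ (σ : Vec (Subset N) k) → bitAt w (⟦ x ⟧ ρ) ≡ c → Sat w (BitF c x) ρ σ
  sat-bit⁺ true  x ρ σ e = sat-branch⁺ x ρ σ e
  sat-bit⁺ false x ρ σ e s with () ← trans (≡.sym e) (sat-branch⁻ x ρ σ s)

  sat-pattern⁻ : ∀ b (z x : Fin n) ρ (σ : Vec (Subset N) k) → Sat w (PatternF b z x) ρ σ →
                 ⟦ x ⟧ ρ ≡ ⟦ z ⟧ ρ + length b × MatchesAt w (⟦ z ⟧ ρ) b
  sat-pattern⁻ []      z x ρ σ z≡x = trans (cong toℕ (≡.sym z≡x)) (≡.sym (ℕP.+-identityʳ _)) , tt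
  sat-pattern⁻ (c ∷ b) z x ρ σ (bit , z′ , z′≡1+z , s)
    with sat-pattern⁻ b Fin.zero (Fin.suc x) (z′ ∷ ρ) σ s
       | sat-succ⁻ (Fin.suc z) Fin.zero (z′ ∷ ρ) σ z′≡1+z
  ... | x≡z′+b , matches | e =
    trans x≡z′+b (trans (cong (_+ length b) e) (≡.sym (ℕP.+-suc _ (length b)))) ,
    sat-bit⁻ c z ρ σ bit , subst (λ m → MatchesAt w m b) e matches

  sat-pattern⁺ : ∀ b (z x : Fin n) ρ (σ : Vec (Subset N) k) →
                 ⟦ x ⟧ ρ ≡ ⟦ z ⟧ ρ + length b → MatchesAt w (⟦ z ⟧ ρ) b → Sat w (PatternF b z x) ρ σ
  sat-pattern⁺ []      z x ρ σ e _ = FinP.toℕ-injective (trans (≡.sym (ℕP.+-identityʳ _)) (≡.sym e))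
  sat-pattern⁺ (c ∷ b) z x ρ σ e (bit , matches) =
    sat-bit⁺ c z ρ σ bit , z′ , sat-succ⁺ (Fin.suc z) Fin.zero (z′ ∷ ρ) σ z′≡1+z ,
    sat-pattern⁺ b Fin.zero (Fin.suc x) (z′ ∷ ρ) σ
      (trans e (trans (ℕP.+-suc _ (length b)) (cong (_+ length b) (≡.sym z′≡1+z))))
      (subst (λ m → MatchesAt w m b) (≡.sym z′≡1+z) matches)
    where
    open Σ (positionBelow (suc (⟦ z ⟧ ρ)) (lookup ρ x)
                          (subst (suc (⟦ z ⟧ ρ) ≤_) (≡.sym e) (ℕP.m<m+n _ (s≤s z≤n))))
      renaming (proj₁ to z′; proj₂ to z′≡1+z)

  module _ (K : ℕ) .{{_ : NonZero K}} where

    sat-child⁻ : ∀ d p q → Sat w (ChildF K d) (p ∷ q ∷ []) [] → ChildSpec w K d (toℕ p) (toℕ q)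
    sat-child⁻ d p q (z , z-multiple , s)
      with sat-multiple⁻ K Fin.zero (z ∷ p ∷ q ∷ []) [] z-multiple
         | sat-⋁⁻ (ChildPatternF K d) (shortBitStrings K) (z ∷ p ∷ q ∷ []) [] s
    ... | divides ℓ z≡ℓK | b , b∈ , sat-pat , branch , offset
      with sat-pattern⁻ b Fin.zero (Fin.suc Fin.zero) (z ∷ p ∷ q ∷ []) [] sat-pat
    ...   | p≡z+b , matches =
      ℓ , b , ∈-shortBitStrings⁻ K b∈ , trans p≡z+b (cong (_+ length b) z≡ℓK) ,
      subst (λ m → MatchesAt w m b) z≡ℓK matches ,
      sat-branch⁻ (Fin.suc Fin.zero) (z ∷ p ∷ q ∷ []) [] branch ,
      sat-offset⁻ (childOffset K d b) (Fin.suc Fin.zero) (Fin.suc (Fin.suc Fin.zero)) (z ∷ p ∷ q ∷ []) [] offset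

    sat-child⁺ : ∀ d p q → ChildSpec w K d (toℕ p) (toℕ q) → Sat w (ChildF K d) (p ∷ q ∷ []) []
    sat-child⁺ d p q (ℓ , b , b<K , p≡ℓK+b , matches , branch , q≡p+offset) =
      z , sat-multiple⁺ K Fin.zero ρ [] (divides ℓ z≡ℓK) ,
      sat-⋁⁺ (ChildPatternF K d) (shortBitStrings K) ρ [] (∈-shortBitStrings⁺ K b b<K)
        (sat-pattern⁺ b Fin.zero (Fin.suc Fin.zero) ρ [] (trans p≡ℓK+b (cong (_+ length b) (≡.sym z≡ℓK)))
                      (subst (λ m → MatchesAt w m b) (≡.sym z≡ℓK) matches) ,
         sat-branch⁺ (Fin.suc Fin.zero) ρ [] branch ,
         sat-offset⁺ (childOffset K d b) (Fin.suc Fin.zero) (Fin.suc (Fin.suc Fin.zero)) ρ [] q≡p+offset)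
      where
      open Σ (positionBelow (ℓ * K) p (subst (ℓ * K ≤_) (≡.sym p≡ℓK+b) (ℕP.m≤m+n _ _)))
        renaming (proj₁ to z; proj₂ to z≡ℓK)
      ρ : Vec (Pos w) 3
      ρ = z ∷ p ∷ q ∷ []

children : Bool → List Bool → List (List Bool)
children true  u = (u ++ false ∷ []) ∷ (u ++ true ∷ []) ∷ []
children false u = []

children-∷ : ∀ c d u → children c (d ∷ u) ≡ map (d ∷_) (children c u)
children-∷ true  d u = refl
children-∷ false d u = refl

at-children : ∀ {X : Set} (isBranching : X → Bool) (address : X → List Bool) xs j x d →
              at xs j ≡ just x → isBranching x ≡ true →
              at (concatMap (λ y → children (isBranching y) (address y)) xs)
                 (childCount (take j (map isBranching xs)) + bitToℕ d)
              ≡ just (address x ++ d ∷ [])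
at-children br addr (y ∷ xs) zero    .y d refl y-branches rewrite y-branches with d
... | false = refl
... | true  = refl
at-children br addr (y ∷ xs) (suc j) x  d e    x-branches with br y
... | true  = at-children br addr xs j x d e x-branches
... | false = at-children br addr xs j x d e x-branches

module _ {A : Set} where

  ∈D-irrelevant : ∀ (t : Tree A) u (p q : u ∈D t) → p ≡ q
  ∈D-irrelevant t            []          p q = refl
  ∈D-irrelevant (node a l r) (false ∷ u) p q = ∈D-irrelevant l u p q
  ∈D-irrelevant (node a l r) (true ∷ u)  p q = ∈D-irrelevant r u p q

  depth : {t : Tree A} → Dom t → ℕ
  depth x = length (proj₁ x)

  indexInLevel : (t : Tree A) (u : List Bool) → u ∈D t → ℕ
  indexInLevel t            []          _ = 0
  indexInLevel (node a l r) (false ∷ u) p = indexInLevel l u p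
  indexInLevel (node a l r) (true ∷ u)  p = length (level l (length u)) + indexInLevel r u p

  index : {t : Tree A} → Dom t → ℕ
  index {t} (u , p) = indexInLevel t u p

  isBranching : {t : Tree A} → Dom t → Bool
  isBranching {t} (u , p) = branching t u p

  private
    inl : ∀ {a} {l r : Tree A} → Dom l → Dom (node a l r)
    inl (u , p) = false ∷ u , p

    inr : ∀ {a} {l r : Tree A} → Dom r → Dom (node a l r)
    inr (u , p) = true ∷ u , p

  at-level : ∀ (t : Tree A) (x : Dom t) → at (level t (depth x)) (index x) ≡ just x
  at-level t            ([] , p) = refl
  at-level (node a l r) (false ∷ u , p) = trans (at-++ˡ L R i (at⇒< L i at-inl)) at-inl
    where
    L : List (Dom (node a l r))
    L = map inl (level l (length u))
    R : List (Dom (node a l r))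
    R = map inr (level r (length u))
    i : ℕ
    i = indexInLevel l u p
    at-inl : at L i ≡ just (false ∷ u , p)
    at-inl = at-map inl (level l (length u)) i (at-level l (u , p))
  at-level (node a l r) (true ∷ u , p) = begin
    at (L ++ R) (length (level l (length u)) + i)
      ≡⟨ cong (λ m → at (L ++ R) (m + i)) (≡.sym (ListP.length-map inl (level l (length u)))) ⟩
    at (L ++ R) (length L + i)  ≡⟨ at-++ʳ L R i ⟩
    at R i                      ≡⟨ at-map inr (level r (length u)) i (at-level r (u , p)) ⟩
    just (true ∷ u , p)         ∎
    where
    open ≡.≡-Reasoning
    L : List (Dom (node a l r))
    L = map inl (level l (length u))
    R : List (Dom (node a l r))
    R = map inr (level r (length u))
    i : ℕ
    i = indexInLevel r u p

  at-level⁻ : ∀ (t : Tree A) ℓ j (x : Dom t) → at (level t ℓ) j ≡ just x → depth x ≡ ℓ × index x ≡ j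
  at-level⁻ t            zero    zero    .([] , _) refl = refl , refl
  at-level⁻ (node a l r) (suc ℓ) j       x         e
    with at-++⁻ (map inl (level l ℓ)) (map inr (level r ℓ)) j e
  ... | inj₁ e′ with at-map⁻ inl (level l ℓ) j e′
  ...   | y , e″ , refl = Data.Product.map₁ (cong suc) (at-level⁻ l ℓ j y e″)
  at-level⁻ (node a l r) (suc ℓ) j x e | inj₂ (j′ , refl , e′) with at-map⁻ inr (level r ℓ) j′ e′
  ...   | y , e″ , refl with at-level⁻ r ℓ j′ y e″
  ...     | refl , refl = refl , cong (_+ index y) (≡.sym (ListP.length-map inl (level l ℓ)))

  childAddresses : {t : Tree A} → Dom t → List (List Bool)
  childAddresses x = children (isBranching x) (proj₁ x)

  childAddresses-shift : ∀ d {s t : Tree A} (e : Dom s → Dom t) →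
                         (∀ x → childAddresses (e x) ≡ map (d ∷_) (childAddresses x)) →
                         ∀ xs → concatMap childAddresses (map e xs) ≡ map (d ∷_) (concatMap childAddresses xs)
  childAddresses-shift d e shift xs = begin
    concatMap childAddresses (map e xs)               ≡⟨ ListP.concatMap-map childAddresses e xs ⟩
    concatMap (childAddresses ∘ e) xs                 ≡⟨ ListP.concatMap-cong shift xs ⟩
    concatMap (map (d ∷_) ∘ childAddresses) xs        ≡⟨ ListP.map-concatMap (d ∷_) childAddresses xs ⟨
    map (d ∷_) (concatMap childAddresses xs)          ∎
    where open ≡.≡-Reasoning

  addresses-shift : ∀ d {s t : Tree A} (e : Dom s → Dom t) → (∀ x → proj₁ (e x) ≡ d ∷ proj₁ x) →
                    ∀ xs → map proj₁ (map e xs) ≡ map (d ∷_) (map proj₁ xs)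
  addresses-shift d e shift xs =
    trans (≡.sym (ListP.map-∘ xs)) (trans (ListP.map-cong shift xs) (ListP.map-∘ xs))

  level-suc : ∀ (t : Tree A) ℓ → map proj₁ (level t (suc ℓ)) ≡ concatMap childAddresses (level t ℓ)
  level-suc (leaf a)     zero    = refl
  level-suc (leaf a)     (suc ℓ) = refl
  level-suc (node a l r) zero    = refl
  level-suc (node a l r) (suc ℓ) = begin
    map proj₁ (map inl (level l (suc ℓ)) ++ map inr (level r (suc ℓ)))
      ≡⟨ ListP.map-++ proj₁ (map inl (level l (suc ℓ))) (map inr (level r (suc ℓ))) ⟩
    map proj₁ (map inl (level l (suc ℓ))) ++ map proj₁ (map inr (level r (suc ℓ)))
      ≡⟨ cong₂ _++_ (addresses-shift false inl (λ _ → refl) (level l (suc ℓ)))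
                    (addresses-shift true inr (λ _ → refl) (level r (suc ℓ))) ⟩
    map (false ∷_) (map proj₁ (level l (suc ℓ))) ++ map (true ∷_) (map proj₁ (level r (suc ℓ)))
      ≡⟨ cong₂ _++_ (cong (map (false ∷_)) (level-suc l ℓ)) (cong (map (true ∷_)) (level-suc r ℓ)) ⟩
    map (false ∷_) (concatMap childAddresses (level l ℓ)) ++ map (true ∷_) (concatMap childAddresses (level r ℓ))
      ≡⟨ cong₂ _++_ (childAddresses-shift false inl (λ x → children-∷ (isBranching x) false (proj₁ x)) (level l ℓ))
                    (childAddresses-shift true inr (λ x → children-∷ (isBranching x) true (proj₁ x)) (level r ℓ)) ⟨
    concatMap childAddresses (map inl (level l ℓ)) ++ concatMap childAddresses (map inr (level r ℓ))
      ≡⟨ ListP.concatMap-++ childAddresses (map inl (level l ℓ)) (map inr (level r ℓ)) ⟨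
    concatMap childAddresses (map inl (level l ℓ) ++ map inr (level r ℓ)) ∎
    where open ≡.≡-Reasoning

  depth≤height : ∀ (t : Tree A) (x : Dom t) → depth x ≤ height t
  depth≤height t            ([] , p)        = z≤n
  depth≤height (node a l r) (false ∷ u , p) = s≤s (ℕP.m≤n⇒m≤n⊔o (height r) (depth≤height l (u , p)))
  depth≤height (node a l r) (true ∷ u , p)  = s≤s (ℕP.m≤n⇒m≤o⊔n (height l) (depth≤height r (u , p)))

  branching-parent : ∀ (t : Tree A) u d → (u ++ d ∷ []) ∈D t → (p : u ∈D t) → branching t u p ≡ true
  branching-parent (node a l r) []          d _ _ = refl
  branching-parent (node a l r) (false ∷ u) d q p = branching-parent l u d q p
  branching-parent (node a l r) (true ∷ u)  d q p = branching-parent r u d q p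

-- The encoding C(t)

module Encoding {A : Set} (K : ℕ) .{{_ : NonZero K}} (t : Tree A) (thin : ThicknessAtMost K t) where

  w : List (Hat A)
  w = C K t

  symbol : Dom t → Hat A
  symbol x = sym (label t (proj₁ x) (proj₂ x)) (isBranching x)

  levelBits : ℕ → List Bool
  levelBits ℓ = map isBranching (level t ℓ)

  code : Dom t → ℕ
  code x = depth x * K + index x

  length-block : ∀ ℓ → length (block K t ℓ) ≡ K
  length-block ℓ = begin
    length (map symbol (level t ℓ) ++ replicate (K ∸ length (level t ℓ)) dollar)
      ≡⟨ ListP.length-++ (map symbol (level t ℓ)) ⟩
    length (map symbol (level t ℓ)) + length (replicate (K ∸ length (level t ℓ)) dollar)
      ≡⟨ cong₂ _+_ (ListP.length-map symbol (level t ℓ)) (ListP.length-replicate (K ∸ length (level t ℓ))) ⟩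
    length (level t ℓ) + (K ∸ length (level t ℓ))
      ≡⟨ ℕP.m+[n∸m]≡n (thin ℓ) ⟩
    K ∎
    where open ≡.≡-Reasoning

  length-C : length w ≡ suc (height t) * K
  length-C = trans (length-concatMap-uniform K (block K t) length-block (upTo (suc (height t))))
                   (cong (_* K) (ListP.length-applyUpTo id (suc (height t))))

  at-C : ∀ ℓ j → ℓ ≤ height t → j < K → at w (ℓ * K + j) ≡ at (block K t ℓ) j
  at-C ℓ j ℓ≤h j<K = at-concatMap-uniform K (block K t) length-block (upTo (suc (height t))) ℓ j
                       (at-applyUpTo id (suc (height t)) ℓ (s≤s ℓ≤h)) j<K

  at-C⁻ : ∀ P {s} → at w P ≡ just s →
          Σ ℕ λ ℓ → Σ ℕ λ j → ℓ ≤ height t × j < K × P ≡ ℓ * K + j × at (block K t ℓ) j ≡ just s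
  at-C⁻ P e with quotient-remainder K P (suc (height t)) (subst (P <_) length-C (at⇒< w P e))
  ... | ℓ , j , s≤s ℓ≤h , j<K , P≡ℓK+j =
    ℓ , j , ℓ≤h , j<K , P≡ℓK+j ,
    trans (≡.sym (at-C ℓ j ℓ≤h j<K)) (subst (λ m → at w m ≡ _) P≡ℓK+j e)

  at-block : ∀ ℓ j {x} → at (level t ℓ) j ≡ just x → at (block K t ℓ) j ≡ just (symbol x)
  at-block ℓ j e =
    let e′ = at-map symbol (level t ℓ) j e
    in trans (at-++ˡ (map symbol (level t ℓ)) _ j (at⇒< (map symbol (level t ℓ)) j e′)) e′

  at-block-padding : ∀ ℓ j → at (level t ℓ) j ≡ nothing → j < K → at (block K t ℓ) j ≡ just dollar
  at-block-padding ℓ j e j<K = begin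
    at (symbols ++ padding) j
      ≡⟨ cong (at (symbols ++ padding)) (≡.sym (ℕP.m+[n∸m]≡n symbols≤j)) ⟩
    at (symbols ++ padding) (length symbols + (j ∸ length symbols))
      ≡⟨ at-++ʳ symbols padding (j ∸ length symbols) ⟩
    at padding (j ∸ length symbols)
      ≡⟨ at-replicate (K ∸ length (level t ℓ)) _ dollar
           (subst (λ m → j ∸ m < K ∸ length (level t ℓ)) (≡.sym (ListP.length-map symbol (level t ℓ)))
                  (ℕP.∸-monoˡ-< j<K (at≡nothing⇒≤ (level t ℓ) j e))) ⟩
    just dollar ∎
    where
    open ≡.≡-Reasoning
    symbols : List (Hat A)
    symbols = map symbol (level t ℓ)
    padding : List (Hat A)
    padding = replicate (K ∸ length (level t ℓ)) dollar
    symbols≤j : length symbols ≤ j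
    symbols≤j = subst (_≤ j) (≡.sym (ListP.length-map symbol (level t ℓ))) (at≡nothing⇒≤ (level t ℓ) j e)

  index<K : ∀ x → index x < K
  index<K x = ℕP.<-≤-trans (at⇒< (level t (depth x)) (index x) (at-level t x)) (thin (depth x))

  at-code : ∀ x → at w (code x) ≡ just (symbol x)
  at-code x = trans (at-C (depth x) (index x) (depth≤height t x) (index<K x)) (at-block (depth x) (index x) (at-level t x))

  code<length : ∀ x → code x < length w
  code<length x = at⇒< w (code x) (at-code x)

  code-injective : ∀ x y → code x ≡ code y → proj₁ x ≡ proj₁ y
  code-injective x y e with quotient-remainder-unique K {depth x} {depth y} (index<K x) (index<K y) e
  ... | depth≡ , index≡ =
    cong proj₁ (just-injective (trans (≡.sym (at-level t x))
      (subst₂ (λ ℓ j → at (level t ℓ) j ≡ just y) (≡.sym depth≡) (≡.sym index≡) (at-level t y))))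

  code-cong : ∀ x y → proj₁ x ≡ proj₁ y → code x ≡ code y
  code-cong (u , p) (.u , q) refl rewrite ∈D-irrelevant t u p q = refl

  at≡sym⇒code : ∀ P a c → at w P ≡ just (sym a c) →
                Σ (Dom t) λ x → code x ≡ P × label t (proj₁ x) (proj₂ x) ≡ a × isBranching x ≡ c
  at≡sym⇒code P a c e with at-C⁻ P e
  ... | ℓ , j , ℓ≤h , j<K , P≡ℓK+j , at-block-j with at (level t ℓ) j in at-level-j
  ...   | nothing with () ← trans (≡.sym (at-block-padding ℓ j at-level-j j<K)) at-block-j
  ...   | just x with just-injective (trans (≡.sym (at-block ℓ j at-level-j)) at-block-j)
  ...     | refl =
    let (depth≡ , index≡) = at-level⁻ t ℓ j x at-level-j
    in x , trans (cong₂ (λ ℓ j → ℓ * K + j) depth≡ index≡) (≡.sym P≡ℓK+j) , refl , refl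

  matchesAt-levelBits : ∀ ℓ → ℓ ≤ height t → MatchesAt w (ℓ * K) (levelBits ℓ)
  matchesAt-levelBits ℓ ℓ≤h = matchesAt-pointwise w (ℓ * K) (levelBits ℓ) λ r e →
    let (x , at-x , c≡) = at-map⁻ isBranching (level t ℓ) r e
        r<K = ℕP.<-≤-trans (at⇒< (level t ℓ) r at-x) (thin ℓ)
    in trans (cong branchBit (trans (at-C ℓ r ℓ≤h r<K) (at-block ℓ r at-x))) (≡.sym c≡)

  ≤length-levelBits : ∀ ℓ j {x} → at (level t ℓ) j ≡ just x → j ≤ length (levelBits ℓ)
  ≤length-levelBits ℓ j at-x =
    subst (j ≤_) (≡.sym (ListP.length-map isBranching (level t ℓ))) (ℕP.<⇒≤ (at⇒< (level t ℓ) j at-x))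

  child-code : ∀ ℓ j x d → at (level t ℓ) j ≡ just x → isBranching x ≡ true →
               Σ (Dom t) λ y → proj₁ y ≡ proj₁ x ++ d ∷ [] ×
                 code y ≡ suc ℓ * K + (childCount (take j (levelBits ℓ)) + bitToℕ d)
  child-code ℓ j x d at-x branches =
    let i = childCount (take j (levelBits ℓ)) + bitToℕ d
        at-child = subst (λ us → at us i ≡ just (proj₁ x ++ d ∷ [])) (≡.sym (level-suc t ℓ))
                         (at-children isBranching proj₁ (level t ℓ) j x d at-x branches)
        (y , at-y , x++d≡y) = at-map⁻ proj₁ (level t (suc ℓ)) i at-child
        (depth≡ , index≡) = at-level⁻ t (suc ℓ) i y at-y
    in y , ≡.sym x++d≡y , cong₂ (λ ℓ j → ℓ * K + j) depth≡ index≡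

  IsChild : Bool → Dom t → Dom t → Set
  IsChild d x y = proj₁ y ≡ proj₁ x ++ d ∷ []

  childSpec⇒child : ∀ d P Q → ChildSpec w K d P Q →
                    Σ (Dom t) λ x → Σ (Dom t) λ y → IsChild d x y × code x ≡ P × code y ≡ Q
  childSpec⇒child d P Q (ℓ , b , b<K , P≡ℓK+b , matches , branch , Q≡P+offset)
    with branchBit≡true (at w P) branch
  ... | a , at-P with at≡sym⇒code P a true at-P
  ...   | x , code-x≡P , _ , branches
    with quotient-remainder-unique K {depth x} {ℓ} (index<K x) b<K (trans code-x≡P P≡ℓK+b)
  ...     | refl , index≡b =
    let at-x : at (level t ℓ) (length b) ≡ just x
        at-x = subst (λ j → at (level t ℓ) j ≡ just x) index≡b (at-level t x)
        b≡ = matchesAt-unique w (ℓ * K) (levelBits ℓ) b (matchesAt-levelBits ℓ (depth≤height t x)) matches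
                              (≤length-levelBits ℓ (length b) at-x)
        (y , y-child , code-y) = child-code ℓ (length b) x d at-x branches
    in x , y , y-child , code-x≡P , (begin
      code y
        ≡⟨ code-y ⟩
      suc ℓ * K + (childCount (take (length b) (levelBits ℓ)) + bitToℕ d)
        ≡⟨ cong (λ b′ → suc ℓ * K + (childCount b′ + bitToℕ d)) (≡.sym b≡) ⟩
      suc ℓ * K + (childCount b + bitToℕ d)
        ≡⟨ next-block-position K ℓ (length b) (childCount b + bitToℕ d) (ℕP.<⇒≤ b<K) ⟩
      ℓ * K + length b + childOffset K d b
        ≡⟨ cong (_+ childOffset K d b) P≡ℓK+b ⟨
      P + childOffset K d b
        ≡⟨ Q≡P+offset ⟨
      Q ∎)
    where open ≡.≡-Reasoning

  child⇒childSpec : ∀ d x y → IsChild d x y → ChildSpec w K d (code x) (code y)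
  child⇒childSpec d x y y-child =
    depth x , b , subst (_< K) (≡.sym length-b) (index<K x) , cong (depth x * K +_) (≡.sym length-b) ,
    matchesAt-take w (depth x * K) (levelBits (depth x)) (matchesAt-levelBits (depth x) (depth≤height t x)) (index x) ,
    trans (cong branchBit (at-code x)) branches , code-y
    where
    open ≡.≡-Reasoning
    b : List Bool
    b = take (index x) (levelBits (depth x))
    length-b : length b ≡ index x
    length-b = trans (ListP.length-take (index x) (levelBits (depth x)))
                     (ℕP.m≤n⇒m⊓n≡m (≤length-levelBits (depth x) (index x) (at-level t x)))
    branches : isBranching x ≡ true
    branches = branching-parent t (proj₁ x) d (subst (_∈D t) y-child (proj₂ y)) (proj₂ x)
    code-y : code y ≡ code x + childOffset K d b
    code-y with child-code (depth x) (index x) x d (at-level t x) branches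
    ... | y′ , y′-child , code-y′ = begin
      code y
        ≡⟨ code-cong y y′ (trans y-child (≡.sym y′-child)) ⟩
      code y′
        ≡⟨ code-y′ ⟩
      suc (depth x) * K + (childCount b + bitToℕ d)
        ≡⟨ next-block-position K (depth x) (index x) (childCount b + bitToℕ d) (ℕP.<⇒≤ (index<K x)) ⟩
      code x + (K ∸ index x + (childCount b + bitToℕ d))
        ≡⟨ cong (λ j → code x + (K ∸ j + (childCount b + bitToℕ d))) length-b ⟨
      code x + childOffset K d b ∎

-- The interpretation

DomainF : {A : Set} → Formula (Hat A) 1 0
DomainF = neg (lab dollar Fin.zero)

LabelF : {A : Set} → A → Formula (Hat A) 1 0
LabelF a = lab (sym a false) Fin.zero ∨F lab (sym a true) Fin.zero

interpretation : {A : Set} → List A → ℕ → Interp A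
interpretation elements K = record { Δ = DomainF ; S′ = ChildF K ; P′ = LabelF }
  where open BranchFormulas elements

module Correctness {A : Set} (_≟A_ : DecidableEquality A) (elements : List A) (complete : ∀ a → a ∈ₗ elements)
                   (K : ℕ) .{{_ : NonZero K}} (t : Tree A) (thin : ThicknessAtMost K t) where

  open Encoding K t thin
  open MSO (_≟Hat_ _≟A_) w
  open BranchSemantics _≟A_ elements complete w
  open BranchFormulas elements

  f : Dom t → Pos w
  f x = fromℕ< (code<length x)

  toℕ-f : ∀ x → toℕ (f x) ≡ code x
  toℕ-f x = FinP.toℕ-fromℕ< (code<length x)

  f≡⇒code≡ : ∀ x p → f x ≡ p → code x ≡ toℕ p
  f≡⇒code≡ x p e = trans (≡.sym (toℕ-f x)) (cong toℕ e)

  code≡⇒f≡ : ∀ x p → code x ≡ toℕ p → f x ≡ p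
  code≡⇒f≡ x p e = FinP.toℕ-injective (trans (toℕ-f x) e)

  f-injective : InjectiveOnDom t f
  f-injective x y e = code-injective x y (trans (≡.sym (toℕ-f x)) (trans (cong toℕ e) (toℕ-f y)))

  InImage : Pos w → Set
  InImage p = Σ (Dom t) λ x → f x ≡ p

  Labelled : A → Pos w → Set
  Labelled a p = Σ (Dom t) λ x → label t (proj₁ x) (proj₂ x) ≡ a × f x ≡ p

  domain : ∀ p → Sat w DomainF (p ∷ []) [] ⇔ InImage p
  domain p = mk⇔ to from
    where
    to : Sat w DomainF (p ∷ []) [] → InImage p
    to s =
      let (a , c , e) = ≢dollar⇒sym (List.lookup w p) s
          (x , code-x , _) = at≡sym⇒code (toℕ p) a c (trans (at-lookup w p) (cong just e))
      in x , code≡⇒f≡ x p code-x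
    from : InImage p → Sat w DomainF (p ∷ []) []
    from (x , fx≡p) s
      with () ← just-injective (trans (≡.sym (at-code x))
                  (trans (cong (at w) (f≡⇒code≡ x p fx≡p)) (sat-lab⁻ dollar Fin.zero (p ∷ []) [] s)))

  Edge : Bool → Pos w → Pos w → Set
  Edge d p q = Σ (Dom t) λ x → Σ (Dom t) λ y → IsChild d x y × f x ≡ p × f y ≡ q

  successor : ∀ d p q → Sat w (ChildF K d) (p ∷ q ∷ []) [] ⇔ Edge d p q
  successor d p q = mk⇔ to from
    where
    to : Sat w (ChildF K d) (p ∷ q ∷ []) [] → Edge d p q
    to s =
      let (x , y , y-child , code-x , code-y) = childSpec⇒child d (toℕ p) (toℕ q) (sat-child⁻ K d p q s)
      in x , y , y-child , code≡⇒f≡ x p code-x , code≡⇒f≡ y q code-y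
    from : Edge d p q → Sat w (ChildF K d) (p ∷ q ∷ []) []
    from (x , y , y-child , fx≡p , fy≡q) =
      sat-child⁺ K d p q (subst₂ (ChildSpec w K d) (f≡⇒code≡ x p fx≡p) (f≡⇒code≡ y q fy≡q)
                                 (child⇒childSpec d x y y-child))

  labels : ∀ a p → Sat w (LabelF a) (p ∷ []) [] ⇔ Labelled a p
  labels a p = mk⇔ to from
    where
    node-at : ∀ c → at w (toℕ p) ≡ just (sym a c) → Labelled a p
    node-at c e = let (x , code-x , label-x , _) = at≡sym⇒code (toℕ p) a c e
                  in x , label-x , code≡⇒f≡ x p code-x

    to : Sat w (LabelF a) (p ∷ []) [] → Labelled a p
    to s = Data.Sum.[ node-at false ∘ sat-lab⁻ (sym a false) Fin.zero (p ∷ []) [] ,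
                      node-at true  ∘ sat-lab⁻ (sym a true)  Fin.zero (p ∷ []) [] ]′
             (sat-∨⁻ (lab (sym a false) Fin.zero) (lab (sym a true) Fin.zero) (p ∷ []) [] s)

    symbol-at : ∀ c → at w (toℕ p) ≡ just (sym a c) → Sat w (LabelF a) (p ∷ []) []
    symbol-at false e = sat-∨⁺ˡ (lab (sym a false) Fin.zero) (lab (sym a true) Fin.zero) (p ∷ []) []
                          (sat-lab⁺ (sym a false) Fin.zero (p ∷ []) [] e)
    symbol-at true  e = sat-∨⁺ʳ (lab (sym a false) Fin.zero) (lab (sym a true) Fin.zero) (p ∷ []) []
                          (sat-lab⁺ (sym a true) Fin.zero (p ∷ []) [] e)

    from : Labelled a p → Sat w (LabelF a) (p ∷ []) []
    from (x , label-x , fx≡p) = symbol-at (isBranching x) (begin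
      at w (toℕ p)                   ≡⟨ cong (at w) (f≡⇒code≡ x p fx≡p) ⟨
      at w (code x)                  ≡⟨ at-code x ⟩
      just (symbol x)                ≡⟨ cong (λ b → just (sym b (isBranching x))) label-x ⟩
      just (sym a (isBranching x))   ∎)
      where open ≡.≡-Reasoning

  isInterpretation : IsMSOInterpretation t w f (interpretation elements K)
  isInterpretation = domain , successor , labels

lemma4p3 : (K : ℕ) → 1 ≤ K → (k : ℕ) →
    Σ (Interp (Fin k)) (λ I → (t : Tree (Fin k)) → ThicknessAtMost K t →
      Σ (Dom t → Pos (C K t)) (λ f →
        InjectiveOnDom t f × IsMSOInterpretation t (C K t) f I))
lemma4p3 K 1≤K k = interpretation (allFin k) K , λ t thin →
  let open Correctness Fin._≟_ (allFin k) ∈-allFin K {{ℕ.>-nonZero 1≤K}} t thin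
  in f , f-injective , isInterpretation
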